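{- Let $(\mathbf{A},\tau)$ be an $n$-subtractive $T_0$-topological algebra. Then: (i) $a\in\Sigma_{\kappa(a)}$ for every $a\in A\setminus\{0\}$; (ii) $R_i\subseteq\Sigma_i$ for every $1\le i\le n-1$; (iii) $\Sigma_{n-1}=A\setminus\{0\}$.
   Context: $\mathbf{A}$ is $n$-subtractive ($n\ge2$) with constant $0$ and binary terms $s_1,\dots,s_{n-1}$ satisfying $s_1(x,x)=0$, $s_j(x,0)=s_{j+1}(x,x)$ ($j=1,\dots,n-2$), $s_{n-1}(x,0)=x$. A topological algebra has a topology making all basic operations continuous; $T_0$ refers to the topology. For $a\in A\setminus\{0\}$, the rank $\kappa(a)$ is the least $k\in\{1,\dots,n-1\}$ with $s_k(a,0)\ne0$. For $0\le i\le n-1$, $R_i=\{a\in A\setminus\{0\}:\kappa(a)\le i\}$ (so $R_0=\emptyset$). For $i\ge1$, $\Sigma_i=\{a\in A:\text{there exist open } U,V \text{ with } a\in U,\ 0\in V,\ U\cap V\subseteq R_{i-1}\}$. -}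

module Defs where

open import Data.Nat using (ℕ; zero; suc; _≤_; _<_; _∸_)
open import Data.Fin using (Fin)
import Data.Fin as F
open import Data.Empty using (⊥)
open import Data.Unit using (⊤)
open import Data.Product using (Σ; ∃; ∃-syntax; _×_; _,_)
open import Data.Sum using (_⊎_)
open import Relation.Nullary using (¬_)
open import Relation.Binary.PropositionalEquality using (_≡_; _≢_)
open import Function.Bundles using (_⇔_)

record Signature : Set₁ where
  field
    Op    : Set
    arity : Op → ℕ
open Signature public

record Algebra (S : Signature) : Set₁ where
  field
    Carrier : Set
    ⟦_⟧     : (o : Op S) → (Fin (arity S o) → Carrier) → Carrier
open Algebra public

data Term (S : Signature) (X : Set) : Set where
  var : X → Term S X
  op  : (o : Op S) → (Fin (arity S o) → Term S X) → Term S X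

eval : {S : Signature} (𝔸 : Algebra S) {X : Set} → (X → Carrier 𝔸) → Term S X → Carrier 𝔸
eval 𝔸 ρ (var x)   = ρ x
eval 𝔸 ρ (op o ts) = ⟦ 𝔸 ⟧ o (λ i → eval 𝔸 ρ (ts i))

evalC : {S : Signature} (𝔸 : Algebra S) → Term S ⊥ → Carrier 𝔸
evalC 𝔸 t = eval 𝔸 (λ ()) t

eval₂ : {S : Signature} (𝔸 : Algebra S) → Term S (Fin 2) → Carrier 𝔸 → Carrier 𝔸 → Carrier 𝔸
eval₂ 𝔸 t x y = eval 𝔸 ρ t
  where
  ρ : Fin 2 → Carrier 𝔸
  ρ F.zero    = x
  ρ (F.suc _) = y

Subset : Set → Set₁
Subset A = A → Set

record Topology (A : Set) : Set₂ where
  field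
    Open      : Subset A → Set
    open-ext  : {U V : Subset A} → (∀ x → U x ⇔ V x) → Open U → Open V
    open-univ : Open (λ _ → ⊤)
    open-∩    : {U V : Subset A} → Open U → Open V → Open (λ x → U x × V x)
    open-⋃    : {I : Set} (U : I → Subset A) → (∀ i → Open (U i))
              → Open (λ x → ∃[ i ] U i x)
open Topology public

-- Continuity of f : A^k → A w.r.t. the product topology on A^k:
-- every point of the preimage of an open set has an open box
-- neighbourhood inside the preimage.
Continuous : {A : Set} (τ : Topology A) (k : ℕ) → ((Fin k → A) → A) → Set₁
Continuous {A} τ k f =
  ∀ (xs : Fin k → A) (U : Subset A) → Open τ U → U (f xs) →
  Σ (Fin k → Subset A) λ V → ((∀ i → Open τ (V i)) × (∀ i → V i (xs i)) ×
          (∀ (ys : Fin k → A) → (∀ i → V i (ys i)) → U (f ys)))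

IsTopologicalAlgebra : {S : Signature} (𝔸 : Algebra S) → Topology (Carrier 𝔸) → Set₁
IsTopologicalAlgebra {S} 𝔸 τ = ∀ (o : Op S) → Continuous τ (arity S o) (⟦ 𝔸 ⟧ o)

IsT₀ : {A : Set} → Topology A → Set₁
IsT₀ {A} τ = ∀ (x y : A) → x ≢ y →
  Σ (Subset A) λ U → (Open τ U × ((U x × ¬ U y) ⊎ (U y × ¬ U x)))

-- 𝔸 is n-subtractive with constant (closed term) 𝟎 and binary terms
-- s 1 , … , s (n-1) (values of s outside 1..n-1 are irrelevant).
record IsSubtractive {S : Signature} (𝔸 : Algebra S) (n : ℕ)
                     (𝟎 : Term S ⊥) (s : ℕ → Term S (Fin 2)) : Set where
  field
    two≤n : 2 ≤ n
    law₁  : ∀ x → eval₂ 𝔸 (s 1) x x ≡ evalC 𝔸 𝟎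
    law₂  : ∀ j → 1 ≤ j → j ≤ n ∸ 2 → ∀ x →
            eval₂ 𝔸 (s j) x (evalC 𝔸 𝟎) ≡ eval₂ 𝔸 (s (suc j)) x x
    law₃  : ∀ x → eval₂ 𝔸 (s (n ∸ 1)) x (evalC 𝔸 𝟎) ≡ x

module Ranks {S : Signature} (𝔸 : Algebra S) (τ : Topology (Carrier 𝔸))
             (n : ℕ) (𝟎 : Term S ⊥) (s : ℕ → Term S (Fin 2)) where

  A : Set
  A = Carrier 𝔸

  0A : A
  0A = evalC 𝔸 𝟎

  IsRank : A → ℕ → Set
  IsRank a k = (1 ≤ k) × (k ≤ n ∸ 1) × (eval₂ 𝔸 (s k) a 0A ≢ 0A)
             × (∀ j → 1 ≤ j → j < k → ¬ (eval₂ 𝔸 (s j) a 0A ≢ 0A))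

  R : ℕ → Subset A
  R i a = (a ≢ 0A) × ∃[ k ] (IsRank a k × k ≤ i)

  Σᵢ : ℕ → A → Set₁
  Σᵢ i a = Σ (Subset A) λ U → Σ (Subset A) λ V → (Open τ U × Open τ V × U a × V 0A ×
                          (∀ b → U b → V b → R (i ∸ 1) b))

module Submission where

open import Defs
open import Data.Nat using (ℕ; _≤_; _∸_)
open import Data.Fin using (Fin)
open import Data.Empty using (⊥)
open import Data.Product using (_×_)
open import Relation.Binary.PropositionalEquality using (_≢_)
open import Function.Bundles using (_⇔_)
open import Axiom.ExcludedMiddle using (ExcludedMiddle)
open import Level using (0ℓ)

open import Data.Nat using (zero; suc; _<_; z≤n; s≤s)
open import Data.Nat.Properties
  using (≤-refl; ≤-trans; <⇒≤; <⇒≤pred; ≮⇒≥; m<n⇒m<1+n; ∸-monoˡ-≤; pred[m∸n]≡m∸[1+n])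
open import Data.Nat.Induction using (<-rec)
import Data.Fin as F
open import Data.Empty using (⊥-elim)
open import Data.Unit using (tt)
open import Data.Product using (Σ; ∃; ∃-syntax; _,_; proj₁; proj₂)
open import Data.Sum using (inj₁; inj₂)
open import Relation.Nullary using (¬_; Dec; yes; no)
open import Relation.Binary.PropositionalEquality using (_≡_; refl; sym; trans; subst)
open import Function using (_∘_)
open import Function.Bundles using (mk⇔)
open import Axiom.DoubleNegationElimination using (em⇒dne)

-- For a ≠ 0 of rank k, s_k(a,0) ≠ 0.  In a T₀ subtractive
-- algebra every x ≠ 0 has an open neighbourhood missing 0: if T₀ only
-- yields an open W ∋ 0 with x ∉ W, the chain s_1(x,x) = 0 ∈ W, …,
-- s_j(x,0) = s_{j+1}(x,x), …, s_{n-1}(x,0) = x ∉ W leaves W at some link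
-- j, and continuity of s_j(x,-) at x gives the neighbourhood.  Separating
-- s_k(a,0) from 0 and pulling back along the continuous term s_k gives
-- U ∋ a, V ∋ 0 with s_k(b,b) ≠ 0 on U ∩ V; then s_{k-1}(b,0) ≠ 0, so b has
-- rank ≤ k-1, which is (i).  Part (ii) follows by monotonicity in the
-- index, and (iii) by applying (ii) to the rank of a ≠ 0, as s_{n-1}(a,0) = a.

Least : (ℕ → Set) → ℕ → Set
Least P k = P k × (∀ j → j < k → ¬ P j)

-- A predicate without a least witness has no witness at all (strong
-- induction: a witness all of whose predecessors fail would be least).
no-least⇒no-witness : (P : ℕ → Set) → ¬ ∃ (Least P) → ∀ j → ¬ P j
no-least⇒no-witness P none = <-rec (λ j → ¬ P j) λ j smaller pj → none (j , pj , λ i i<j → smaller i<j)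

least-witness : ExcludedMiddle 0ℓ → (P : ℕ → Set) → ∀ {m} → P m →
                ∃[ k ] (k ≤ m × Least P k)
least-witness lem P {m} pm with em⇒dne lem (λ none → no-least⇒no-witness P none m pm)
... | k , pk , below = k , ≮⇒≥ (λ m<k → below m m<k pm) , pk , below

least-positive-witness : ExcludedMiddle 0ℓ → (P : ℕ → Set) → ∀ {m} → 1 ≤ m → P m →
  ∃[ k ] (1 ≤ k × k ≤ m × P k × (∀ j → 1 ≤ j → j < k → ¬ P j))
least-positive-witness lem P {suc m} _ pm with least-witness lem (P ∘ suc) pm
... | k , k≤m , pk , below = suc k , s≤s z≤n , s≤s k≤m , pk , λ { (suc j) _ (s≤s j<k) → below j j<k }

crossing : ExcludedMiddle 0ℓ → (P Q : ℕ → Set) → P 1 → ∀ m →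
           (∀ j → 1 ≤ j → j < m → Q j → P (suc j)) → 1 ≤ m → ¬ Q m →
           ∃[ j ] (P j × ¬ Q j)
crossing lem P Q p₁ (suc zero) _ _ ¬qm = 1 , p₁ , ¬qm
crossing lem P Q p₁ (suc (suc m)) link _ ¬qm =
  last-link (lem {Q (suc m)})
            (crossing lem P Q p₁ (suc m) (λ j 1≤j j<m → link j 1≤j (m<n⇒m<1+n j<m)) (s≤s z≤n))
  where
  -- Either the last link already crosses, or the chain is shorter by one.
  last-link : Dec (Q (suc m)) → (¬ Q (suc m) → ∃[ j ] (P j × ¬ Q j)) → ∃[ j ] (P j × ¬ Q j)
  last-link (yes q)  _       = suc (suc m) , link (suc m) (s≤s z≤n) ≤-refl q , ¬qm
  last-link (no ¬q) shorter = shorter ¬q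

module _ {A : Set} (τ : Topology A) where

  guarded-open : {P : Set} {O : Subset A} → Dec P → Open τ O → Open τ (λ y → P → O y)
  guarded-open (yes p) oO = open-ext τ (λ y → mk⇔ (λ o _ → o) (λ f → f p)) oO
  guarded-open (no ¬p) _  = open-ext τ (λ y → mk⇔ (λ _ p → ⊥-elim (¬p p)) (λ _ → tt)) (open-univ τ)

  ⋂-open : ∀ {m} (O : Fin m → Subset A) → (∀ i → Open τ (O i)) → Open τ (λ x → ∀ i → O i x)
  ⋂-open {zero} O _ = open-ext τ (λ x → mk⇔ (λ _ ()) (λ _ → tt)) (open-univ τ)
  ⋂-open {suc m} O oO =
    open-ext τ (λ x → mk⇔ (λ { (p , q) F.zero → p ; (p , q) (F.suc i) → q i })
                           (λ h → h F.zero , h ∘ F.suc))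
               (open-∩ τ (oO F.zero) (⋂-open (O ∘ F.suc) (oO ∘ F.suc)))

  BoxNeighbourhood : ∀ k → ((Fin k → A) → A) → (Fin k → A) → Subset A → Set₁
  BoxNeighbourhood k f xs U =
    Σ (Fin k → Subset A) λ W → (∀ v → Open τ (W v)) × (∀ v → W v (xs v)) ×
      (∀ ys → (∀ v → W v (ys v)) → U (f ys))

  ⋂-boxes : ∀ {m k} (g : Fin m → (Fin k → A) → A) (xs : Fin k → A) (V : Fin m → Subset A) →
    (∀ i → BoxNeighbourhood k (g i) xs (V i)) →
    Σ (Fin k → Subset A) λ W → (∀ v → Open τ (W v)) × (∀ v → W v (xs v)) ×
      (∀ ys → (∀ v → W v (ys v)) → ∀ i → V i (g i ys))
  ⋂-boxes {m} {k} g xs V boxes =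
    (λ v y → ∀ i → box i v y) , (λ v → ⋂-open (λ i → box i v) (λ i → open-box i v)) ,
    (λ v i → xs∈box i v) , λ ys ys∈W i → box⊆V i ys (λ v → ys∈W v i)
    where
    box : Fin m → Fin k → Subset A
    box i = proj₁ (boxes i)
    open-box : ∀ i v → Open τ (box i v)
    open-box i = proj₁ (proj₂ (boxes i))
    xs∈box : ∀ i v → box i v (xs v)
    xs∈box i = proj₁ (proj₂ (proj₂ (boxes i)))
    box⊆V : ∀ i ys → (∀ v → box i v (ys v)) → V i (g i ys)
    box⊆V i = proj₂ (proj₂ (proj₂ (boxes i)))

module TermContinuity {S : Signature} (𝔸 : Algebra S) (τ : Topology (Carrier 𝔸))
                      (top : IsTopologicalAlgebra 𝔸 τ) where

  -- Induction on the term, intersecting the boxes obtained for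
  -- the immediate subterms.
  term-continuous : ∀ {k} (t : Term S (Fin k)) → Continuous τ k (λ ρ → eval 𝔸 ρ t)
  term-continuous (var x) ρ U oU p =
    (λ v y → v ≡ x → U y) , (λ v → guarded-open τ (v F.≟ x) oU) , (λ { v refl → p }) ,
    λ ρ′ inBox → inBox x refl
  term-continuous (op o ts) ρ U oU p with top o (λ i → eval 𝔸 ρ (ts i)) U oU p
  ... | V , oV , ρ∈V , V⊆U
    with ⋂-boxes τ (λ i ρ′ → eval 𝔸 ρ′ (ts i)) ρ V
                 (λ i → term-continuous (ts i) ρ (V i) (oV i) (ρ∈V i))
  ... | W , oW , ρ∈W , W⊆V = W , oW , ρ∈W , λ ρ′ ρ′∈W → V⊆U _ (W⊆V ρ′ ρ′∈W)

  binary-term-continuous : (t : Term S (Fin 2)) (x y : Carrier 𝔸) (O : Subset (Carrier 𝔸)) →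
    Open τ O → O (eval₂ 𝔸 t x y) →
    Σ (Subset (Carrier 𝔸)) λ P → Σ (Subset (Carrier 𝔸)) λ Q →
      Open τ P × Open τ Q × P x × Q y × (∀ x′ y′ → P x′ → Q y′ → O (eval₂ 𝔸 t x′ y′))
  binary-term-continuous t x y O oO p with term-continuous t _ O oO p
  ... | W , oW , ρ∈W , W⊆O = W F.zero , W (F.suc F.zero) , oW _ , oW _ , ρ∈W _ , ρ∈W _ ,
        λ x′ y′ x′∈P y′∈Q → W⊆O _ λ { F.zero → x′∈P ; (F.suc F.zero) → y′∈Q }

module Subtractive (lem : ExcludedMiddle 0ℓ) {S : Signature} (𝔸 : Algebra S)
                   (τ : Topology (Carrier 𝔸)) (top : IsTopologicalAlgebra 𝔸 τ) (t₀ : IsT₀ τ)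
                   (n : ℕ) (𝟎 : Term S ⊥) (s : ℕ → Term S (Fin 2))
                   (subtractive : IsSubtractive 𝔸 n 𝟎 s) where

  open Ranks 𝔸 τ n 𝟎 s
  open IsSubtractive subtractive
  open TermContinuity 𝔸 τ top using (binary-term-continuous)

  sₐ : ℕ → A → A → A
  sₐ j = eval₂ 𝔸 (s j)

  1≤n-1 : 1 ≤ n ∸ 1
  1≤n-1 = ∸-monoˡ-≤ 1 two≤n

  chain-law : ∀ j → 1 ≤ j → j < n ∸ 1 → ∀ x → sₐ j x 0A ≡ sₐ (suc j) x x
  chain-law j 1≤j j<n-1 = law₂ j 1≤j (subst (j ≤_) (pred[m∸n]≡m∸[1+n] n 1) (<⇒≤pred j<n-1))

  sₐ-zero : ∀ j → 1 ≤ j → j ≤ n ∸ 1 → sₐ j 0A 0A ≡ 0A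
  sₐ-zero (suc zero)    _ _ = law₁ 0A
  sₐ-zero (suc (suc j)) _ j<n-1 =
    trans (sym (chain-law (suc j) (s≤s z≤n) j<n-1 0A)) (sₐ-zero (suc j) (s≤s z≤n) (<⇒≤ j<n-1))

  -- In a T₀ subtractive algebra every x ≠ 0 has an open neighbourhood
  -- missing 0.  If T₀ gives W ∋ 0 with x ∉ W instead, the chain
  -- s_1(x,x) = 0 ∈ W, …, s_{n-1}(x,0) = x ∉ W leaves W at some j, and the
  -- continuity of s_j(x,-) at x yields the neighbourhood.
  zero-separated : ∀ x → x ≢ 0A → Σ (Subset A) λ O → Open τ O × O x × ¬ O 0A
  zero-separated x x≢0 with t₀ x 0A x≢0
  ... | U , oU , inj₁ (x∈U , 0∉U) = U , oU , x∈U , 0∉U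
  ... | W , oW , inj₂ (0∈W , x∉W)
    with crossing lem (λ j → W (sₐ j x x)) (λ j → W (sₐ j x 0A))
                  (subst W (sym (law₁ x)) 0∈W) (n ∸ 1)
                  (λ j 1≤j j<n-1 → subst W (chain-law j 1≤j j<n-1 x))
                  1≤n-1 (λ w → x∉W (subst W (law₃ x) w))
  ... | j , xx∈W , x0∉W with binary-term-continuous (s j) x x W oW xx∈W
  ... | P , Q , _ , oQ , x∈P , x∈Q , PQ⊆W = Q , oQ , x∈Q , λ 0∈Q → x0∉W (PQ⊆W x 0A x∈P 0∈Q)

  nonzero-value⇒R : ∀ {b} j → 1 ≤ j → j ≤ n ∸ 1 → sₐ j b 0A ≢ 0A → R j b
  nonzero-value⇒R {b} j 1≤j j≤n-1 nz = b≢0 , rank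
    where
    b≢0 : b ≢ 0A
    b≢0 refl = nz (sₐ-zero j 1≤j j≤n-1)

    rank : ∃[ k ] (IsRank b k × k ≤ j)
    rank with least-positive-witness lem (λ i → sₐ i b 0A ≢ 0A) 1≤j nz
    ... | k , 1≤k , k≤j , nzₖ , below = k , (1≤k , ≤-trans k≤j j≤n-1 , nzₖ , below) , k≤j

  -- If s_k(b,b) ≠ 0 then b ∈ R_{k-1}: for k = 1 this is impossible as
  -- s_1(b,b) = 0, otherwise s_{k-1}(b,0) = s_k(b,b) ≠ 0.
  nonzero-diagonal⇒R : ∀ {b} k → 1 ≤ k → k ≤ n ∸ 1 → sₐ k b b ≢ 0A → R (k ∸ 1) b
  nonzero-diagonal⇒R {b} (suc zero)    _ _     nz = ⊥-elim (nz (law₁ b))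
  nonzero-diagonal⇒R {b} (suc (suc k)) _ k<n-1 nz =
    nonzero-value⇒R (suc k) (s≤s z≤n) (<⇒≤ k<n-1)
                    (λ e → nz (trans (sym (chain-law (suc k) (s≤s z≤n) k<n-1 b)) e))

  -- If s_k(a,0) ≠ 0 there are open U ∋ a and V ∋ 0 with s_k(b,b) ≠ 0 on
  -- U ∩ V: separate s_k(a,0) from 0 and pull back along s_k.
  nonzero-neighbourhoods : ∀ a k → sₐ k a 0A ≢ 0A →
    Σ (Subset A) λ U → Σ (Subset A) λ V → Open τ U × Open τ V × U a × V 0A ×
      (∀ b → U b → V b → sₐ k b b ≢ 0A)
  nonzero-neighbourhoods a k nz with zero-separated (sₐ k a 0A) nz
  ... | O , oO , value∈O , 0∉O with binary-term-continuous (s k) a 0A O oO value∈O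
  ... | U , V , oU , oV , a∈U , 0∈V , UV⊆O =
        U , V , oU , oV , a∈U , 0∈V , λ b b∈U b∈V e → 0∉O (subst O e (UV⊆O b b b∈U b∈V))

  rank∈Σ : ∀ a k → IsRank a k → Σᵢ k a
  rank∈Σ a k (1≤k , k≤n-1 , nz , _) with nonzero-neighbourhoods a k nz
  ... | U , V , oU , oV , a∈U , 0∈V , diagonal≢0 =
        U , V , oU , oV , a∈U , 0∈V , λ b b∈U b∈V → nonzero-diagonal⇒R k 1≤k k≤n-1 (diagonal≢0 b b∈U b∈V)

  Σ-mono : ∀ {i j a} → i ≤ j → Σᵢ i a → Σᵢ j a
  Σ-mono {i} {j} i≤j (U , V , oU , oV , a∈U , 0∈V , UV⊆R) =
    U , V , oU , oV , a∈U , 0∈V , λ b b∈U b∈V → R-mono (UV⊆R b b∈U b∈V)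
    where
    R-mono : ∀ {b} → R (i ∸ 1) b → R (j ∸ 1) b
    R-mono (b≢0 , k , rank , k≤i) = b≢0 , k , rank , ≤-trans k≤i (∸-monoˡ-≤ 1 i≤j)

  R⊆Σ : ∀ {i a} → R i a → Σᵢ i a
  R⊆Σ {a = a} (_ , k , rank , k≤i) = Σ-mono k≤i (rank∈Σ a k rank)

  Σ⊆nonzero : ∀ {i a} → Σᵢ i a → a ≢ 0A
  Σ⊆nonzero (U , V , _ , _ , a∈U , 0∈V , UV⊆R) refl = proj₁ (UV⊆R _ a∈U 0∈V) refl

  -- Part (iii): Σ_{n-1} = A ∖ {0}, as s_{n-1}(a,0) = a puts every a ≠ 0 in R_{n-1}.
  Σ-top : ∀ a → Σᵢ (n ∸ 1) a ⇔ (a ≢ 0A)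
  Σ-top a = mk⇔ (Σ⊆nonzero {n ∸ 1}) λ a≢0 →
    R⊆Σ {n ∸ 1} (nonzero-value⇒R (n ∸ 1) 1≤n-1 ≤-refl (λ e → a≢0 (trans (sym (law₃ a)) e)))

theorem6p18 : ExcludedMiddle 0ℓ →
    {S : Signature} (𝔸 : Algebra S) (τ : Topology (Carrier 𝔸)) →
    IsTopologicalAlgebra 𝔸 τ → IsT₀ τ →
    (n : ℕ) (𝟎 : Term S ⊥) (s : ℕ → Term S (Fin 2)) → IsSubtractive 𝔸 n 𝟎 s →
    (∀ (a : Carrier 𝔸) → a ≢ Ranks.0A 𝔸 τ n 𝟎 s → ∀ k → Ranks.IsRank 𝔸 τ n 𝟎 s a k →
       Ranks.Σᵢ 𝔸 τ n 𝟎 s k a)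
    × (∀ i → 1 ≤ i → i ≤ n ∸ 1 → ∀ (a : Carrier 𝔸) →
       Ranks.R 𝔸 τ n 𝟎 s i a → Ranks.Σᵢ 𝔸 τ n 𝟎 s i a)
    × (∀ (a : Carrier 𝔸) → Ranks.Σᵢ 𝔸 τ n 𝟎 s (n ∸ 1) a ⇔ (a ≢ Ranks.0A 𝔸 τ n 𝟎 s))
theorem6p18 lem 𝔸 τ top t₀ n 𝟎 s subtractive =
  (λ a _ → rank∈Σ a) , (λ _ _ _ _ → R⊆Σ) , Σ-top
  where open Subtractive lem 𝔸 τ top t₀ n 𝟎 s subtractive
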